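{- Let $G$ be a finite simple graph, $k\ge1$, and let $X$ be a clique of the $k$-supertoken graph $\mathcal F_k(G)$. Then there exists a clique $K$ of $G$ with $|K|=|X|$.
   Context: For a finite simple graph $G$ and integer $k\ge 1$, the $k$-supertoken graph $\mathcal F_k(G)$ has as vertices all multisets of size $k$ of elements of $V(G)$; two multisets $A,B$ are adjacent iff $A=S\uplus\{u\}$, $B=S\uplus\{v\}$ for some multiset $S$ of size $k-1$ and some edge $uv\in E(G)$, where $\uplus$ is multiset sum. -}

module Defs where

open import Data.Nat using (ℕ; zero; suc; _+_; _∸_)
open import Data.Fin using (Fin; zero; suc; _≟_)
open import Data.Product using (Σ; ∃; _×_)
open import Data.List using (List)
open import Data.List.Relation.Unary.AllPairs using (AllPairs)
open import Relation.Binary.PropositionalEquality using (_≡_)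
open import Relation.Nullary using (¬_; does)
open import Data.Bool using (if_then_else_)

record SimpleGraph (n : ℕ) : Set₁ where
  field
    Adj     : Fin n → Fin n → Set
    sym     : ∀ {u v} → Adj u v → Adj v u
    irrefl  : ∀ {u} → ¬ Adj u u
open SimpleGraph public

total : ∀ {n} → (Fin n → ℕ) → ℕ
total {zero}  f = 0
total {suc n} f = f zero + total (λ i → f (suc i))

record Multiset (n k : ℕ) : Set where
  constructor mset
  field
    count : Fin n → ℕ
    size  : total count ≡ k
open Multiset public

single : ∀ {n} → Fin n → Fin n → ℕ
single u i = if does (u ≟ i) then 1 else 0

SupertokenAdj : ∀ {n} (G : SimpleGraph n) (k : ℕ) → Multiset n k → Multiset n k → Set
SupertokenAdj {n} G k A B =
  Σ (Multiset n (k ∸ 1)) λ S → Σ (Fin n) λ u → Σ (Fin n) λ v →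
    Adj G u v ×
    (∀ i → count A i ≡ count S i + single u i) ×
    (∀ i → count B i ≡ count S i + single v i)

-- A clique of G: a list of vertices, any two (at distinct positions) adjacent.
-- (Adjacency is irreflexive, so the entries are distinct; |K| = length K.)
IsClique : ∀ {n} (G : SimpleGraph n) → List (Fin n) → Set
IsClique G K = AllPairs (Adj G) K

IsSupertokenClique : ∀ {n} (G : SimpleGraph n) (k : ℕ) → List (Multiset n k) → Set
IsSupertokenClique G k X = AllPairs (SupertokenAdj G k) X

-- Fix a member A₁ of the clique X. Every other member A arises from A₁ by moving one token
-- along an edge of G, from u to v say; record this as the arc (u , v). If A and B (with arc
-- (u' , v')) are adjacent too, B arising from A by moving a token from x to y, then the three
-- moves yield the multiset identity {v, y, u'} = {v', x, u}. As G has no loops, its only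
-- solutions say that the two arcs share their tail and have adjacent heads, or share their
-- head and have adjacent tails. Once two arcs share their tail, every further arc must share
-- it as well (dually for heads), so this common vertex together with the other endpoints of
-- the arcs is a clique of G of size |X|.
module Submission where

open import Defs hiding (sym)
open import Algebra.Properties.CommutativeSemigroup using (x∙yz≈y∙xz; xy∙z≈xz∙y)
open import Data.Nat using (ℕ; _≤_; suc; _+_; s≤s)
open import Data.Nat.Properties using (+-cancelˡ-≡; 1+n≢0; +-commutativeSemigroup)
open import Data.Nat.Tactic.RingSolver using (solve-∀)
open import Data.Fin using (Fin; zero; _≟_)
open import Data.List using (List; []; _∷_; length; map)
open import Data.List.Properties using (length-map)
open import Data.List.Membership.Propositional using (_∈_)
open import Data.List.Relation.Unary.Any using (here; there; _─_)
open import Data.List.Relation.Unary.All using (All; []; _∷_)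
import Data.List.Relation.Unary.All as All
import Data.List.Relation.Unary.All.Properties as All
open import Data.List.Relation.Unary.AllPairs using (AllPairs; []; _∷_)
import Data.List.Relation.Unary.AllPairs as AllPairs
import Data.List.Relation.Unary.AllPairs.Properties as AllPairs
open import Data.Product using (Σ; _×_; _,_; proj₁; proj₂; swap; uncurry)
open import Data.Sum using (_⊎_; inj₁; inj₂)
open import Data.Empty using (⊥-elim)
open import Function using (_∘_)
open import Relation.Nullary using (yes; no)
open import Relation.Binary.PropositionalEquality
  using (_≡_; _≢_; _≗_; refl; sym; trans; cong; cong₂; subst; module ≡-Reasoning)

module _ {n : ℕ} where

  single-self : (a : Fin n) → single a a ≡ 1
  single-self a with a ≟ a
  ... | yes _   = refl
  ... | no a≢a = ⊥-elim (a≢a refl)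

  bag : List (Fin n) → Fin n → ℕ
  bag []       i = 0
  bag (x ∷ xs) i = single x i + bag xs i

  bag≢0⇒∈ : ∀ {a} ys → bag ys a ≢ 0 → a ∈ ys
  bag≢0⇒∈ []       bag≢0 = ⊥-elim (bag≢0 refl)
  bag≢0⇒∈ {a} (y ∷ ys) bag≢0 with y ≟ a
  ... | yes refl = here refl
  ... | no _     = there (bag≢0⇒∈ ys bag≢0)

  bag-─ : ∀ {a ys} (a∈ys : a ∈ ys) → ∀ i → bag ys i ≡ single a i + bag (ys ─ a∈ys) i
  bag-─ (here refl) i = refl
  bag-─ {a} {y ∷ ys} (there a∈ys) i = begin
    single y i + bag ys i                           ≡⟨ cong (single y i +_) (bag-─ a∈ys i) ⟩
    single y i + (single a i + bag (ys ─ a∈ys) i)   ≡⟨ x∙yz≈y∙xz +-commutativeSemigroup (single y i) (single a i) _ ⟩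
    single a i + (single y i + bag (ys ─ a∈ys) i)   ∎
    where open ≡-Reasoning

  -- A record rather than bag xs ≗ bag ys, since bag is not injective and the lists
  -- could not be inferred from the latter.
  record SameBag (xs ys : List (Fin n)) : Set where
    constructor sameBag
    field bag≗ : bag xs ≗ bag ys

  bag-uncons : ∀ {a xs ys} → SameBag (a ∷ xs) ys →
               Σ (a ∈ ys) λ a∈ys → SameBag xs (ys ─ a∈ys)
  bag-uncons {a} {xs} {ys} (sameBag eq) = a∈ys , sameBag λ i →
    +-cancelˡ-≡ (single a i) _ _ (trans (eq i) (bag-─ a∈ys i))
    where
    bag≡suc : bag ys a ≡ suc (bag xs a)
    bag≡suc = trans (sym (eq a)) (cong (_+ bag xs a) (single-self a))

    a∈ys : a ∈ ys
    a∈ys = bag≢0⇒∈ ys (1+n≢0 ∘ trans (sym bag≡suc))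

vertexOf : ∀ {n k} → Multiset n (suc k) → Fin n
vertexOf {suc n} _ = zero

module _ {n : ℕ} (G : SimpleGraph n) where

  adj⇒≢ : ∀ {u v} → Adj G u v → u ≢ v
  adj⇒≢ uv refl = irrefl G uv

  Arc : Set
  Arc = Fin n × Fin n

  Edge : Arc → Set
  Edge (u , v) = Adj G u v

  Linked : Arc → Arc → Set
  Linked (u , v) (u' , v') = (u ≡ u' × Adj G v v') ⊎ (v ≡ v' × Adj G u u')

  Linked-swap : ∀ {p q} → Linked p q → Linked (swap p) (swap q)
  Linked-swap (inj₁ l) = inj₂ l
  Linked-swap (inj₂ l) = inj₁ l

  Linked-sameTail⇒adj : ∀ {u v w} → Linked (u , v) (u , w) → Adj G v w
  Linked-sameTail⇒adj (inj₁ (_ , vw))  = vw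
  Linked-sameTail⇒adj (inj₂ (_ , uu)) = ⊥-elim (irrefl G uu)

  Linked-fan⇒sameTail : ∀ {u v w r} → Adj G v w →
                           Linked (u , v) r → Linked (u , w) r → u ≡ proj₁ r
  Linked-fan⇒sameTail vw (inj₁ (u≡ , _)) _                = u≡
  Linked-fan⇒sameTail vw (inj₂ _)        (inj₁ (u≡ , _)) = u≡
  Linked-fan⇒sameTail vw (inj₂ (v≡ , _)) (inj₂ (w≡ , _)) = ⊥-elim (adj⇒≢ vw (trans v≡ (sym w≡)))

  sameTail⇒fan : ∀ {u} {Ps : List Arc} → All ((u ≡_) ∘ proj₁) Ps → Ps ≡ map (u ,_) (map proj₂ Ps)
  sameTail⇒fan []          = refl
  sameTail⇒fan (refl ∷ us) = cong (_ ∷_) (sameTail⇒fan us)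

  fan-clique : ∀ u vs → All Edge (map (u ,_) vs) → AllPairs Linked (map (u ,_) vs) →
               IsClique G (u ∷ vs)
  fan-clique u vs edges linked =
    All.map⁻ edges ∷ AllPairs.map Linked-sameTail⇒adj (AllPairs.map⁻ linked)

  Clique : ℕ → Set
  Clique m = Σ (List (Fin n)) λ K → IsClique G K × length K ≡ m

  linkedFan⇒clique : ∀ {u v w} rest → Adj G v w →
                     let Ps = (u , v) ∷ (u , w) ∷ rest in
                     All Edge Ps → AllPairs Linked Ps → Clique (suc (length Ps))
  linkedFan⇒clique {u} {v} {w} rest vw edges linked@((_ ∷ linked-v) ∷ linked-w ∷ _) =
    u ∷ map proj₂ Ps ,
    fan-clique u (map proj₂ Ps)
      (subst (All Edge) Ps≡fan edges) (subst (AllPairs Linked) Ps≡fan linked) ,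
    cong suc (length-map proj₂ Ps)
    where
    Ps = (u , v) ∷ (u , w) ∷ rest
    Ps≡fan : Ps ≡ map (u ,_) (map proj₂ Ps)
    Ps≡fan = sameTail⇒fan
      (refl ∷ refl ∷ All.zipWith (uncurry (Linked-fan⇒sameTail vw)) (linked-v , linked-w))

  linkedArcs⇒clique : Fin n → (Ps : List Arc) → All Edge Ps → AllPairs Linked Ps →
                      Clique (suc (length Ps))
  linkedArcs⇒clique w [] _ _ = w ∷ [] , [] ∷ [] , refl
  linkedArcs⇒clique _ ((u , v) ∷ []) (uv ∷ []) _ = u ∷ v ∷ [] , (uv ∷ []) ∷ [] ∷ [] , refl
  linkedArcs⇒clique _ (_ ∷ _ ∷ rest) edges linked@((inj₁ (refl , vw) ∷ _) ∷ _) =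
    linkedFan⇒clique rest vw edges linked
  linkedArcs⇒clique _ (_ ∷ _ ∷ rest) edges linked@((inj₂ (refl , uw) ∷ _) ∷ _) =
    let K , isClique , |K|≡ = linkedFan⇒clique (map swap rest) uw
          (All.map⁺ (All.map (SimpleGraph.sym G) edges))
          (AllPairs.map⁺ (AllPairs.map Linked-swap linked))
    in K , isClique , trans |K|≡ (cong (suc ∘ suc ∘ suc) (length-map swap rest))

  module _ {k : ℕ} where

    -- SupertokenAdj G k A B unfolds to a Σ-type that does not determine A and B, hence
    -- they are passed explicitly here and often at the call sites below.
    arc : ∀ A B → SupertokenAdj G k A B → Arc
    arc _ _ (_ , u , v , _) = u , v

    arc-edge : ∀ {A B} (A~B : SupertokenAdj G k A B) → Edge (arc A B A~B)
    arc-edge (_ , _ , _ , uv , _) = uv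

    arc-exchange : ∀ {A B} (A~B : SupertokenAdj G k A B) → let (u , v) = arc A B A~B in
                   ∀ i → count A i + single v i ≡ count B i + single u i
    arc-exchange {A} {B} (S , u , v , _ , A≡S+u , B≡S+v) i = begin
      count A i + single v i               ≡⟨ cong (_+ single v i) (A≡S+u i) ⟩
      count S i + single u i + single v i  ≡⟨ xy∙z≈xz∙y +-commutativeSemigroup (count S i) _ (single v i) ⟩
      count S i + single v i + single u i  ≡⟨ cong (_+ single u i) (sym (B≡S+v i)) ⟩
      count B i + single u i               ∎
      where open ≡-Reasoning

    arcs-triangle : ∀ {A₁ A B} (A₁~A : SupertokenAdj G k A₁ A) (A₁~B : SupertokenAdj G k A₁ B)
                    (A~B : SupertokenAdj G k A B) →
                    let (u , v) = arc A₁ A A₁~A ; (u' , v') = arc A₁ B A₁~B ; (x , y) = arc A B A~B in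
                    SameBag (v ∷ y ∷ u' ∷ []) (v' ∷ x ∷ u ∷ [])
    arcs-triangle {A₁} {A} {B} A₁~A@(_ , u , v , _) A₁~B@(_ , u' , v' , _) A~B@(_ , x , y , _) =
      sameBag λ i → +-cancelˡ-≡ (count A₁ i + count A i + count B i) _ _ (begin
        count A₁ i + count A i + count B i + bag (v ∷ y ∷ u' ∷ []) i
          ≡⟨ regroup (count A₁ i) (count A i) (count B i) (single v i) (single y i) (single u' i) ⟩
        (count A₁ i + single v i) + (count A i + single y i) + (count B i + single u' i)
          ≡⟨ cong₂ _+_ (cong₂ _+_ (arc-exchange {A₁} {A} A₁~A i) (arc-exchange {A} {B} A~B i))
                       (sym (arc-exchange {A₁} {B} A₁~B i)) ⟩
        (count A i + single u i) + (count B i + single x i) + (count A₁ i + single v' i)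
          ≡⟨ regroup′ (count A₁ i) (count A i) (count B i) (single v' i) (single x i) (single u i) ⟩
        count A₁ i + count A i + count B i + bag (v' ∷ x ∷ u ∷ []) i ∎)
      where
      open ≡-Reasoning
      regroup : ∀ a₁ a b p q r → a₁ + a + b + (p + (q + (r + 0))) ≡ (a₁ + p) + (a + q) + (b + r)
      regroup = solve-∀
      regroup′ : ∀ a₁ a b p q r → (a + r) + (b + q) + (a₁ + p) ≡ a₁ + a + b + (p + (q + (r + 0)))
      regroup′ = solve-∀

    arcs-linked : ∀ {A₁ A B} (A₁~A : SupertokenAdj G k A₁ A) (A₁~B : SupertokenAdj G k A₁ B) →
                  SupertokenAdj G k A B → Linked (arc A₁ A A₁~A) (arc A₁ B A₁~B)
    arcs-linked {A₁} {A} {B} A₁~A@(_ , _ , _ , uv , _) A₁~B@(_ , _ , _ , u'v' , _) A~B@(_ , _ , _ , xy , _)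
      with bag-uncons (arcs-triangle {A₁} {A} {B} A₁~A A₁~B A~B)
    ... | here refl , yu'≈xu with bag-uncons yu'≈xu
    ...   | here refl , _ = ⊥-elim (irrefl G xy)
    ...   | there (here refl) , u'≈x with bag-uncons u'≈x
    ...     | here refl , _ = inj₂ (refl , SimpleGraph.sym G xy)
    arcs-linked {A₁} {A} {B} A₁~A@(_ , _ , _ , uv , _) A₁~B@(_ , _ , _ , u'v' , _) A~B@(_ , _ , _ , xy , _)
        | there (here refl) , yu'≈v'u with bag-uncons yu'≈v'u
    ...   | here refl , u'≈u with bag-uncons u'≈u
    ...     | here refl , _ = inj₁ (refl , xy)
    arcs-linked {A₁} {A} {B} A₁~A@(_ , _ , _ , uv , _) A₁~B@(_ , _ , _ , u'v' , _) A~B@(_ , _ , _ , xy , _)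
        | there (here refl) , yu'≈v'u | there (here refl) , u'≈v' with bag-uncons u'≈v'
    ...     | here refl , _ = ⊥-elim (irrefl G u'v')
    arcs-linked {A₁} {A} {B} A₁~A@(_ , _ , _ , uv , _) A₁~B@(_ , _ , _ , u'v' , _) A~B@(_ , _ , _ , xy , _)
        | there (there (here refl)) , _ = ⊥-elim (irrefl G uv)

    module _ (A₁ : Multiset n k) where

      arcs : ∀ {As} → All (SupertokenAdj G k A₁) As → List Arc
      arcs []                     = []
      arcs {A ∷ _} (A₁~A ∷ A₁~As) = arc A₁ A A₁~A ∷ arcs A₁~As

      length-arcs : ∀ {As} (A₁~As : All (SupertokenAdj G k A₁) As) → length (arcs A₁~As) ≡ length As
      length-arcs []          = refl
      length-arcs (_ ∷ A₁~As) = cong suc (length-arcs A₁~As)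

      arcs-edges : ∀ {As} (A₁~As : All (SupertokenAdj G k A₁) As) → All Edge (arcs A₁~As)
      arcs-edges []                     = []
      arcs-edges {A ∷ _} (A₁~A ∷ A₁~As) = arc-edge {A₁} {A} A₁~A ∷ arcs-edges A₁~As

      arcs-linkedFrom : ∀ {A As} (A₁~A : SupertokenAdj G k A₁ A) (A₁~As : All (SupertokenAdj G k A₁) As) →
                        All (SupertokenAdj G k A) As → All (Linked (arc A₁ A A₁~A)) (arcs A₁~As)
      arcs-linkedFrom _ [] [] = []
      arcs-linkedFrom {A} {B ∷ _} A₁~A (A₁~B ∷ A₁~As) (A~B ∷ A~As) =
        arcs-linked {A₁} {A} {B} A₁~A A₁~B A~B ∷ arcs-linkedFrom {A} A₁~A A₁~As A~As

      arcs-pairwiseLinked : ∀ {As} (A₁~As : All (SupertokenAdj G k A₁) As) →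
                            IsSupertokenClique G k As → AllPairs Linked (arcs A₁~As)
      arcs-pairwiseLinked [] [] = []
      arcs-pairwiseLinked {A ∷ _} (A₁~A ∷ A₁~As) (A~As ∷ clique) =
        arcs-linkedFrom {A} A₁~A A₁~As A~As ∷ arcs-pairwiseLinked A₁~As clique

mainTheorem7 : (n : ℕ) (G : SimpleGraph n) (k : ℕ) → 1 ≤ k →
    (X : List (Multiset n k)) → IsSupertokenClique G k X →
    Σ (List (Fin n)) λ K → IsClique G K × length K ≡ length X
mainTheorem7 n G k _ [] _ = [] , [] , refl
mainTheorem7 n G (suc k) (s≤s _) (A₁ ∷ _) (A₁~As ∷ clique) =
  let K , isClique , |K|≡ = linkedArcs⇒clique G (vertexOf A₁) (arcs G A₁ A₁~As)
                              (arcs-edges G A₁ A₁~As) (arcs-pairwiseLinked G A₁ A₁~As clique)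
  in K , isClique , trans |K|≡ (cong suc (length-arcs G A₁ A₁~As))
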